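{- According to relative interval analysis, $l(\mathrm{Nai},\mathrm{Eag})=[-\frac14,1]$, i.e., $\mathrm{Min}(\mathrm{Nai},\mathrm{Eag})=-\frac14$ and $\mathrm{Max}(\mathrm{Nai},\mathrm{Eag})=1$.
   Context: Online frequent items problem: an input sequence is $I=a_1,\ldots,a_n$ of items from an infinite universe, $n=|I|$. An algorithm maintains a buffer holding one item; $s_t$ is the buffer content after step $t$; at step $1$ the buffer receives $a_1$, and at each later step $t$ the algorithm either keeps $s_{t-1}$ or replaces it by $a_t$. With $f_I(a)=|\{i:a_i=a\}|/n$, the aggregate frequency of $\mathcal A$ on $I$ is $\mathcal A(I)=\sum_{t=1}^n f_I(s^{\mathcal A}_t)$. Nai sets $s_t=a_t$ for all $t$. Eag: let $t^*=\min\{t\in\{1,\ldots,n-1\}: a_t=a_{t+1}\}$ if such $t$ exists, else $t^*=n$; Eag sets $s_t=a_t$ for $t\le t^*$ and $s_t=a_{t^*}$ for $t>t^*$. Relative interval analysis: $\mathrm{Min}_{\mathcal A,\mathcal B}(n)=\min_{|I|=n}\{\mathcal A(I)-\mathcal B(I)\}$, $\mathrm{Max}_{\mathcal A,\mathcal B}(n)=\max_{|I|=n}\{\mathcal A(I)-\mathcal B(I)\}$, $\mathrm{Min}(\mathcal A,\mathcal B)=\liminf_{n\to\infty}\mathrm{Min}_{\mathcal A,\mathcal B}(n)/n$, $\mathrm{Max}(\mathcal A,\mathcal B)=\limsup_{n\to\infty}\mathrm{Max}_{\mathcal A,\mathcal B}(n)/n$, and the relative interval is $l(\mathcal A,\mathcal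 B)=[\mathrm{Min}(\mathcal A,\mathcal B),\mathrm{Max}(\mathcal A,\mathcal B)]$. -}

module Defs where

open import Data.Nat as ℕ using (ℕ; zero; suc; _≡ᵇ_)
open import Data.Bool using (if_then_else_)
open import Data.Integer using (+_)
open import Data.List using (List; []; _∷_; length; replicate; map; foldr)
open import Data.Rational using (ℚ; _/_; 0ℚ; _+_; _-_; _*_; _≤_; _<_)
open import Data.Product using (Σ; _×_)
open import Relation.Binary.PropositionalEquality using (_≡_)

-- Items come from the infinite universe ℕ.  An input is a list of items.

count : List ℕ → ℕ → ℕ
count [] a = zero
count (x ∷ I) a = if x ≡ᵇ a then suc (count I a) else count I a

-- 1 / m as a rational (only used for m = |I| ≥ 1; 1/0 is set to 0)
inv : ℕ → ℚ
inv zero = 0ℚ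
inv (suc m) = + 1 / suc m

freq : List ℕ → ℕ → ℚ
freq I a = (+ count I a / 1) * inv (length I)

sumℚ : List ℚ → ℚ
sumℚ = foldr _+_ 0ℚ

-- aggregate frequency of a buffer-content sequence s_1..s_n on input I
aggregate : List ℕ → List ℕ → ℚ
aggregate I s = sumℚ (map (freq I) s)

naiBuffer : List ℕ → List ℕ
naiBuffer I = I

-- Eag: s_t = a_t for t ≤ t*, s_t = a_{t*} for t > t*,
-- where t* is the first t with a_t = a_{t+1} (or n if none)
eagBuffer : List ℕ → List ℕ
eagBuffer [] = []
eagBuffer (x ∷ []) = x ∷ []
eagBuffer (x ∷ y ∷ r) =
  if x ≡ᵇ y then x ∷ replicate (length (y ∷ r)) x else x ∷ eagBuffer (y ∷ r)

Nai : List ℕ → ℚ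
Nai I = aggregate I (naiBuffer I)

Eag : List ℕ → ℚ
Eag I = aggregate I (eagBuffer I)

diffRatio : List ℕ → ℚ
diffRatio I = (Nai I - Eag I) * inv (length I)

-- Min(A,B) = L, i.e. liminf_{n→∞} (min_{|I|=n} D(I)) / n = L, unfolded:
--  (i) for every ε > 0, for all sufficiently large n, every input of size n has D(I)/n ≥ L - ε;
-- (ii) for every ε > 0 and every N there are n ≥ N and an input of size n with D(I)/n ≤ L + ε.
MinIs : (List ℕ → ℚ) → ℚ → Set
MinIs d L =
  ((ε : ℚ) → 0ℚ < ε → Σ ℕ λ N → (n : ℕ) → N ℕ.≤ n →
     (I : List ℕ) → length I ≡ n → L - ε ≤ d I)
  × ((ε : ℚ) → 0ℚ < ε → (N : ℕ) → Σ ℕ λ n → N ℕ.≤ n ×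
     Σ (List ℕ) λ I → length I ≡ n × d I ≤ L + ε)

-- Max(A,B) = U, i.e. limsup_{n→∞} (max_{|I|=n} D(I)) / n = U, unfolded dually.
MaxIs : (List ℕ → ℚ) → ℚ → Set
MaxIs d U =
  ((ε : ℚ) → 0ℚ < ε → Σ ℕ λ N → (n : ℕ) → N ℕ.≤ n →
     (I : List ℕ) → length I ≡ n → d I ≤ U + ε)
  × ((ε : ℚ) → 0ℚ < ε → (N : ℕ) → Σ ℕ λ n → N ℕ.≤ n ×
     Σ (List ℕ) λ I → length I ≡ n × U - ε ≤ d I)

module Submission where

-- For an input I of length n write S = n·Nai(I) = Σ_t count(a_t) and
-- E = n·Eag(I), so that diffRatio I = (S − E)/n².  The proof has three parts.
--  1. Limits (minIs-intro, maxIs-intro): a value that bounds diffRatio on every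
--     input and is approached with error O(1/k) along inputs of length ≥ k is
--     its Min (resp. Max); only an Archimedean estimate is needed.
--  2. Uniform bounds, over ℕ: every count is ≤ n, so S ≤ n² and diffRatio ≤ 1.
--     Eag's buffer is a prefix of I followed by one item b repeated
--     (eag-shape); comparing with Nai and using AM–GM gives 4E ≤ 4S + n², i.e.
--     diffRatio ≥ −1/4.  Rationals are handled as unnormalised fractions
--     (a − b)/(1 + q), compared by cross-multiplication over ℕ (fraction-≤).
--  3. Extremal families: 0 0 k 0 (k−1) 0 … 1 0 has diffRatio −1/4 + 1/(4(k+1)),
--     and 0 0 1 … 1 (k ones) has diffRatio 1 − (6k+4)/(k+2)².
-- theorem5 combines the three parts.

open import Defs
open import Data.Bool using (true; false; T; if_then_else_)
open import Data.Integer as ℤ using (ℤ; +_; -[1+_]; +[1+_])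
import Data.Integer.Properties as ℤP
import Data.Integer.Tactic.RingSolver as ℤSolver
open import Data.List using (List; []; _∷_; _++_; length; map; replicate)
open import Data.Nat.ListAction using (sum)
open import Data.Nat.ListAction.Properties using (sum-++)
open import Data.List.Properties using (map-++; length-replicate)
open import Data.Nat as ℕ using (ℕ; zero; suc; _+_; _*_; _≤_; _<_; z≤n; s≤s; _≡ᵇ_)
import Data.Nat.Properties as ℕP
import Data.Nat.Tactic.RingSolver as ℕSolver
open import Data.Empty using (⊥-elim)
open import Data.Product using (Σ; ∃; _×_; _,_)
open import Data.Sum using (inj₁; inj₂)
open import Data.Rational as ℚ using (ℚ; mkℚ; toℚᵘ; _/_; 0ℚ)
import Data.Rational.Properties as ℚP
open import Data.Rational.Unnormalised as ℚᵘ using (ℚᵘ; mkℚᵘ; _≃_; *≡*; *≤*)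
import Data.Rational.Unnormalised.Properties as ℚᵘP
open import Data.Rational.Unnormalised.Solver using (module +-*-Solver)
open import Relation.Binary.PropositionalEquality

≤-by-slack : ∀ {x y} t → x + t ≡ y → x ≤ y
≤-by-slack {x} t eq = subst (x ≤_) eq (ℕP.m≤m+n x t)

-- For ε > 0, eventually c/(1 + k) ≤ ε (write ε = (1 + p)/(1 + d) and take k ≥ c(1 + d)).
eventually-≤ : ∀ c ε → 0ℚ ℚ.< ε → Σ ℕ λ K → ∀ k → K ≤ k → + c / suc k ℚ.≤ ε
eventually-≤ c ε@(mkℚ +[1+ p ] d _) _ = c * suc d , small
  where
  small : ∀ k → c * suc d ≤ k → + c / suc k ℚ.≤ ε
  small k K≤k = ℚP.toℚᵘ-cancel-≤ (ℚᵘP.≤-respˡ-≃ (ℚᵘP.≃-sym (ℚP.toℚᵘ-fromℚᵘ (mkℚᵘ (+ c) k)))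
    (*≤* (subst₂ ℤ._≤_ (ℤP.pos-* c (suc d)) (ℤP.pos-* (suc p) (suc k)) (ℤ.+≤+ cross))))
    where
    cross : c * suc d ≤ suc p * suc k
    cross = ℕP.≤-trans K≤k (ℕP.≤-trans (ℕP.n≤1+n k) (ℕP.m≤n*m (suc k) (suc p)))
eventually-≤ c (mkℚ (+ zero)   d _) (ℚ.*<* (ℤ.+<+ ()))
eventually-≤ c (mkℚ -[1+ _ ] d _) (ℚ.*<* ())

minIs-intro : ∀ (d : List ℕ → ℚ) L (W : ℕ → List ℕ) c → (∀ I → L ℚ.≤ d I) →
              (∀ k → k ≤ length (W k)) → (∀ k → d (W k) ℚ.≤ L ℚ.+ + c / suc k) → MinIs d L
minIs-intro d L W c bound long close =
    (λ ε ε>0 → 0 , λ _ _ I _ → ℚP.≤-trans (L-ε≤L ε>0) (bound I))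
  , λ ε ε>0 N → let (K , small) = eventually-≤ c ε ε>0 in
      length (W (K + N)) , ℕP.≤-trans (ℕP.m≤n+m N K) (long (K + N)) , W (K + N) , refl ,
      ℚP.≤-trans (close (K + N)) (ℚP.+-monoʳ-≤ L (small (K + N) (ℕP.m≤m+n K N)))
  where
  L-ε≤L : ∀ {ε} → 0ℚ ℚ.< ε → L ℚ.- ε ℚ.≤ L
  L-ε≤L ε>0 = ℚP.≤-trans (ℚP.+-monoʳ-≤ L (ℚP.neg-antimono-≤ (ℚP.<⇒≤ ε>0)))
                         (ℚP.≤-reflexive (ℚP.+-identityʳ L))

maxIs-intro : ∀ (d : List ℕ → ℚ) U (W : ℕ → List ℕ) c → (∀ I → d I ℚ.≤ U) →
              (∀ k → k ≤ length (W k)) → (∀ k → U ℚ.- + c / suc k ℚ.≤ d (W k)) → MaxIs d U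
maxIs-intro d U W c bound long close =
    (λ ε ε>0 → 0 , λ _ _ I _ → ℚP.≤-trans (bound I) (U≤U+ε ε>0))
  , λ ε ε>0 N → let (K , small) = eventually-≤ c ε ε>0 in
      length (W (K + N)) , ℕP.≤-trans (ℕP.m≤n+m N K) (long (K + N)) , W (K + N) , refl ,
      ℚP.≤-trans (ℚP.+-monoʳ-≤ U (ℚP.neg-antimono-≤ (small (K + N) (ℕP.m≤m+n K N)))) (close (K + N))
  where
  U≤U+ε : ∀ {ε} → 0ℚ ℚ.< ε → U ℚ.≤ U ℚ.+ ε
  U≤U+ε ε>0 = ℚP.≤-trans (ℚP.≤-reflexive (sym (ℚP.+-identityʳ U))) (ℚP.+-monoʳ-≤ U (ℚP.<⇒≤ ε>0))

weight : (ℕ → ℕ) → List ℕ → ℕ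
weight c L = sum (map c L)

weight-++ : ∀ c xs ys → weight c (xs ++ ys) ≡ weight c xs + weight c ys
weight-++ c xs ys = trans (cong sum (map-++ c xs ys)) (sum-++ (map c xs) (map c ys))

weight-replicate : ∀ c k b → weight c (replicate k b) ≡ k * c b
weight-replicate c zero    b = refl
weight-replicate c (suc k) b = cong (λ w → c b + w) (weight-replicate c k b)

≡ᵇ-true⇒≡ : ∀ {x b} → (x ≡ᵇ b) ≡ true → x ≡ b
≡ᵇ-true⇒≡ {x} {b} eq = ℕP.≡ᵇ⇒≡ x b (subst T (sym eq) _)

count≤length : ∀ I a → count I a ≤ length I
count≤length []      a = z≤n
count≤length (x ∷ I) a with x ≡ᵇ a
... | true  = s≤s (count≤length I a)
... | false = ℕP.m≤n⇒m≤1+n (count≤length I a)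

count-here : ∀ a I → count (a ∷ I) a ≡ suc (count I a)
count-here a I with a ≡ᵇ a in a≡ᵇa
... | true  = refl
... | false = ⊥-elim (subst T a≡ᵇa (ℕP.≡⇒≡ᵇ a a refl))

count-there : ∀ {x a} I → x ≢ a → count (x ∷ I) a ≡ count I a
count-there {x} {a} I x≢a with x ≡ᵇ a in x≡ᵇa
... | true  = ⊥-elim (x≢a (≡ᵇ-true⇒≡ {x} {a} x≡ᵇa))
... | false = refl

weight-count≤ : ∀ I L → weight (count I) L ≤ length L * length I
weight-count≤ I []      = z≤n
weight-count≤ I (x ∷ L) = ℕP.+-mono-≤ (count≤length I x) (weight-count≤ I L)

misses : List ℕ → ℕ → ℕ
misses []      b = 0
misses (x ∷ L) b = if x ≡ᵇ b then misses L b else suc (misses L b)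

count+misses : ∀ L b → count L b + misses L b ≡ length L
count+misses []      b = refl
count+misses (x ∷ L) b with x ≡ᵇ b
... | true  = cong suc (count+misses L b)
... | false = trans (ℕP.+-suc (count L b) (misses L b)) (cong suc (count+misses L b))

misses-suffix : ∀ P T b → misses T b ≤ misses (P ++ T) b
misses-suffix []      T b = ℕP.≤-refl
misses-suffix (x ∷ P) T b with x ≡ᵇ b
... | true  = misses-suffix P T b
... | false = ℕP.m≤n⇒m≤1+n (misses-suffix P T b)

-- n · Nai(I) and n · Eag(I): the total count of the buffer contents
naiMass eagMass : List ℕ → ℕ
naiMass I = weight (count I) (naiBuffer I)
eagMass I = weight (count I) (eagBuffer I)

naiMass≤square : ∀ I → naiMass I ≤ length I * length I
naiMass≤square I = weight-count≤ I I

replace-by : ∀ c b T → length T * c b ≤ weight c T + misses T b * c b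
replace-by c b []      = z≤n
replace-by c b (x ∷ T) with x ≡ᵇ b in x≡ᵇb
... | true with refl ← ≡ᵇ-true⇒≡ {x} {b} x≡ᵇb =
  subst (c b + length T * c b ≤_) (sym (ℕP.+-assoc (c b) _ _))
        (ℕP.+-monoʳ-≤ (c b) (replace-by c b T))
... | false = begin
  c b + length T * c b                      ≤⟨ ℕP.+-monoʳ-≤ (c b) (replace-by c b T) ⟩
  c b + (weight c T + misses T b * c b)     ≤⟨ ℕP.m≤n+m _ (c x) ⟩
  c x + (c b + (weight c T + misses T b * c b)) ≡⟨ regroup (c x) (c b) (weight c T) (misses T b * c b) ⟩
  (c x + weight c T) + (c b + misses T b * c b) ∎
  where
  open ℕP.≤-Reasoning
  regroup : ∀ u v w z → u + (v + (w + z)) ≡ (u + w) + (v + z)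
  regroup = ℕSolver.solve-∀

eag-shape : ∀ L → ∃ λ P → ∃ λ T → ∃ λ b →
            L ≡ P ++ T × eagBuffer L ≡ P ++ replicate (length T) b
eag-shape []          = [] , [] , 0 , refl , refl
eag-shape (x ∷ [])    = x ∷ [] , [] , 0 , refl , refl
eag-shape (x ∷ y ∷ r) with x ≡ᵇ y | eag-shape (y ∷ r)
... | true  | _ = [] , x ∷ y ∷ r , x , refl , refl
... | false | P , T , b , split , buffer =
  x ∷ P , T , b , cong (x ∷_) split , cong (x ∷_) buffer

four-mul≤square-ordered : ∀ {x y} → x ≤ y → 4 * x * y ≤ (x + y) * (x + y)
four-mul≤square-ordered {x} x≤y with ℕP.m≤n⇒∃[o]m+o≡n x≤y
... | d , refl = ≤-by-slack (d * d) (square-expand x d)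
  where
  square-expand : ∀ x d → 4 * x * (x + d) + d * d ≡ (x + (x + d)) * (x + (x + d))
  square-expand = ℕSolver.solve-∀

four-mul≤square : ∀ x y → 4 * x * y ≤ (x + y) * (x + y)
four-mul≤square x y with ℕP.≤-total x y
... | inj₁ x≤y = four-mul≤square-ordered x≤y
... | inj₂ y≤x = subst₂ _≤_ (swap₁ y x) (swap₂ y x) (four-mul≤square-ordered y≤x)
  where
  swap₁ : ∀ y x → 4 * y * x ≡ 4 * x * y
  swap₁ = ℕSolver.solve-∀
  swap₂ : ∀ y x → (y + x) * (y + x) ≡ (x + y) * (x + y)
  swap₂ = ℕSolver.solve-∀

-- Write I = P ++ T with Eag repeating b along T.  On T, Eag gains at most
-- q · count(b) over Nai, where q = misses T b; and q + count(b) ≤ n gives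
-- 4 q count(b) ≤ n² by AM–GM.
eagMass-bound : ∀ I → 4 * eagMass I ≤ 4 * naiMass I + length I * length I
eagMass-bound I with eag-shape I
... | P , T , b , split , buffer = begin
  4 * eagMass I                                  ≡⟨ cong (λ s → 4 * weight c s) buffer ⟩
  4 * weight c (P ++ replicate (length T) b)     ≡⟨ cong (4 *_) eag-weight ⟩
  4 * (weight c P + length T * c b)              ≤⟨ ℕP.*-monoʳ-≤ 4 (ℕP.+-monoʳ-≤ (weight c P) (replace-by c b T)) ⟩
  4 * (weight c P + (weight c T + q * c b))      ≡⟨ regroup (weight c P) (weight c T) q (c b) ⟩
  4 * (weight c P + weight c T) + 4 * q * c b    ≡⟨ cong (λ s → 4 * s + 4 * q * c b) nai-weight ⟩
  4 * naiMass I + 4 * q * c b                    ≤⟨ ℕP.+-monoʳ-≤ (4 * naiMass I) (four-mul≤square q (c b)) ⟩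
  4 * naiMass I + (q + c b) * (q + c b)          ≤⟨ ℕP.+-monoʳ-≤ (4 * naiMass I) (ℕP.*-mono-≤ q+cb≤n q+cb≤n) ⟩
  4 * naiMass I + length I * length I            ∎
  where
  open ℕP.≤-Reasoning
  c = count I
  q = misses T b

  eag-weight : weight c (P ++ replicate (length T) b) ≡ weight c P + length T * c b
  eag-weight = trans (weight-++ c P _) (cong (λ w → weight c P + w) (weight-replicate c (length T) b))

  nai-weight : weight c P + weight c T ≡ naiMass I
  nai-weight = sym (trans (cong (weight c) split) (weight-++ c P T))

  regroup : ∀ u v x y → 4 * (u + (v + x * y)) ≡ 4 * (u + v) + 4 * x * y
  regroup = ℕSolver.solve-∀

  q+cb≤n : q + c b ≤ length I
  q+cb≤n = begin
    q + c b          ≤⟨ ℕP.+-monoˡ-≤ (c b) (subst (λ L → q ≤ misses L b) (sym split) (misses-suffix P T b)) ⟩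
    misses I b + c b ≡⟨ ℕP.+-comm (misses I b) (c b) ⟩
    c b + misses I b ≡⟨ count+misses I b ⟩
    length I         ∎

fraction : ℕ → ℕ → ℕ → ℚᵘ
fraction a b q = mkℚᵘ (+ a ℤ.- + b) q

pos-bilinear : ∀ x y u v → + (x * y + u * v) ≡ + x ℤ.* + y ℤ.+ + u ℤ.* + v
pos-bilinear x y u v =
  trans (ℤP.pos-+ (x * y) (u * v)) (cong₂ ℤ._+_ (ℤP.pos-* x y) (ℤP.pos-* u v))

fraction-≤ : ∀ a b p c d q → a * suc q + d * suc p ≤ c * suc p + b * suc q →
             fraction a b p ℚᵘ.≤ fraction c d q
fraction-≤ a b p c d q h with ℕP.m≤n⇒∃[o]m+o≡n h
... | t , slack = *≤* (begin
  (+ a ℤ.- + b) ℤ.* Q                               ≤⟨ ℤP.i≤i+j _ (+ t) ⟩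
  (+ a ℤ.- + b) ℤ.* Q ℤ.+ + t                       ≡⟨ expand (+ a) (+ b) (+ d) Q P (+ t) ⟩
  (+ a ℤ.* Q ℤ.+ + d ℤ.* P ℤ.+ + t) ℤ.- (+ d ℤ.* P ℤ.+ + b ℤ.* Q)
    ≡⟨ cong (ℤ._- (+ d ℤ.* P ℤ.+ + b ℤ.* Q)) lifted-slack ⟩
  (+ c ℤ.* P ℤ.+ + b ℤ.* Q) ℤ.- (+ d ℤ.* P ℤ.+ + b ℤ.* Q) ≡⟨ cancel (+ c) (+ b) (+ d) Q P ⟩
  (+ c ℤ.- + d) ℤ.* P                               ∎)
  where
  open ℤP.≤-Reasoning
  P = + suc p
  Q = + suc q
  lifted-slack : + a ℤ.* Q ℤ.+ + d ℤ.* P ℤ.+ + t ≡ + c ℤ.* P ℤ.+ + b ℤ.* Q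
  lifted-slack = begin-equality
    + a ℤ.* Q ℤ.+ + d ℤ.* P ℤ.+ + t  ≡⟨ cong (ℤ._+ + t) (pos-bilinear a (suc q) d (suc p)) ⟨
    + (a * suc q + d * suc p) ℤ.+ + t ≡⟨ ℤP.pos-+ (a * suc q + d * suc p) t ⟨
    + (a * suc q + d * suc p + t)     ≡⟨ cong +_ slack ⟩
    + (c * suc p + b * suc q)         ≡⟨ pos-bilinear c (suc p) b (suc q) ⟩
    + c ℤ.* P ℤ.+ + b ℤ.* Q           ∎
  expand : ∀ a b d Q P t → (a ℤ.- b) ℤ.* Q ℤ.+ t ≡ (a ℤ.* Q ℤ.+ d ℤ.* P ℤ.+ t) ℤ.- (d ℤ.* P ℤ.+ b ℤ.* Q)
  expand = ℤSolver.solve-∀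
  cancel : ∀ c b d Q P → (c ℤ.* P ℤ.+ b ℤ.* Q) ℤ.- (d ℤ.* P ℤ.+ b ℤ.* Q) ≡ (c ℤ.- d) ℤ.* P
  cancel = ℤSolver.solve-∀

fraction-+ : ∀ a b p c d q →
             fraction a b p ℚᵘ.+ fraction c d q
               ≃ fraction (a * suc q + c * suc p) (b * suc q + d * suc p) (q + p * suc q)
fraction-+ a b p c d q = *≡* (cong (ℤ._* + suc (q + p * suc q)) numerators)
  where
  open ≡-Reasoning
  numerators : (+ a ℤ.- + b) ℤ.* + suc q ℤ.+ (+ c ℤ.- + d) ℤ.* + suc p
               ≡ + (a * suc q + c * suc p) ℤ.- + (b * suc q + d * suc p)
  numerators = begin
    (+ a ℤ.- + b) ℤ.* + suc q ℤ.+ (+ c ℤ.- + d) ℤ.* + suc p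
      ≡⟨ collect (+ a) (+ b) (+ c) (+ d) (+ suc q) (+ suc p) ⟩
    (+ a ℤ.* + suc q ℤ.+ + c ℤ.* + suc p) ℤ.- (+ b ℤ.* + suc q ℤ.+ + d ℤ.* + suc p)
      ≡⟨ cong₂ ℤ._-_ (pos-bilinear a (suc q) c (suc p)) (pos-bilinear b (suc q) d (suc p)) ⟨
    + (a * suc q + c * suc p) ℤ.- + (b * suc q + d * suc p) ∎
    where
    collect : ∀ a b c d Q P → (a ℤ.- b) ℤ.* Q ℤ.+ (c ℤ.- d) ℤ.* P ≡ (a ℤ.* Q ℤ.+ c ℤ.* P) ℤ.- (b ℤ.* Q ℤ.+ d ℤ.* P)
    collect = ℤSolver.solve-∀

toℚᵘ-fraction : ∀ c q → toℚᵘ (+ c / suc q) ≃ fraction c 0 q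
toℚᵘ-fraction c q = ℚᵘP.≃-trans (ℚP.toℚᵘ-fromℚᵘ (mkℚᵘ (+ c) q))
  (ℚᵘP.≃-reflexive (cong (λ i → mkℚᵘ i q) (sym (ℤP.+-identityʳ (+ c)))))

toℚᵘ-neg-fraction : ∀ c q → toℚᵘ (ℚ.- (+ c / suc q)) ≃ fraction 0 c q
toℚᵘ-neg-fraction c q = ℚᵘP.≃-trans (ℚP.toℚᵘ-homo‿- (+ c / suc q))
  (ℚᵘP.≃-trans (ℚᵘP.-‿cong (ℚP.toℚᵘ-fromℚᵘ (mkℚᵘ (+ c) q)))
    (ℚᵘP.≃-reflexive (cong (λ i → mkℚᵘ i q) (sym (ℤP.+-identityˡ (ℤ.- + c))))))

naturals-add : ∀ a b → mkℚᵘ (+ a) 0 ℚᵘ.+ mkℚᵘ (+ b) 0 ≃ mkℚᵘ (+ (a + b)) 0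
naturals-add a b = *≡* (cong (ℤ._* + 1) (trans
  (cong₂ ℤ._+_ (ℤP.*-identityʳ (+ a)) (ℤP.*-identityʳ (+ b))) (sym (ℤP.pos-+ a b))))

aggregate-≃ : ∀ (c : ℕ → ℕ) (v : ℚ) s →
  toℚᵘ (sumℚ (map (λ a → (+ c a / 1) ℚ.* v) s)) ≃ mkℚᵘ (+ weight c s) 0 ℚᵘ.* toℚᵘ v
aggregate-≃ c v []      = ℚᵘP.≃-sym (ℚᵘP.*-zeroˡ (toℚᵘ v))
aggregate-≃ c v (x ∷ s) = begin
  toℚᵘ ((+ c x / 1) ℚ.* v ℚ.+ rest)
    ≈⟨ ℚP.toℚᵘ-homo-+ ((+ c x / 1) ℚ.* v) rest ⟩
  toℚᵘ ((+ c x / 1) ℚ.* v) ℚᵘ.+ toℚᵘ rest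
    ≈⟨ ℚᵘP.+-cong (ℚᵘP.≃-trans (ℚP.toℚᵘ-homo-* (+ c x / 1) v)
                     (ℚᵘP.*-congʳ {V} (ℚP.toℚᵘ-fromℚᵘ (mkℚᵘ (+ c x) 0))))
                  (aggregate-≃ c v s) ⟩
  mkℚᵘ (+ c x) 0 ℚᵘ.* V ℚᵘ.+ mkℚᵘ (+ weight c s) 0 ℚᵘ.* V
    ≈⟨ ℚᵘP.*-distribʳ-+ V (mkℚᵘ (+ c x) 0) (mkℚᵘ (+ weight c s) 0) ⟨
  (mkℚᵘ (+ c x) 0 ℚᵘ.+ mkℚᵘ (+ weight c s) 0) ℚᵘ.* V
    ≈⟨ ℚᵘP.*-congʳ {V} (naturals-add (c x) (weight c s)) ⟩
  mkℚᵘ (+ weight c (x ∷ s)) 0 ℚᵘ.* V ∎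
  where
  open ℚᵘP.≃-Reasoning
  rest = sumℚ (map (λ a → (+ c a / 1) ℚ.* v) s)
  V = toℚᵘ v

-- The central identity: for |I| = 1 + m,
--   diffRatio I = (n·Nai(I) − n·Eag(I)) / n²   with n² = 1 + (m + m(1+m)).
diffRatio-≃ : ∀ I {m} → length I ≡ suc m →
              toℚᵘ (diffRatio I) ≃ fraction (naiMass I) (eagMass I) (m + m * suc m)
diffRatio-≃ I {m} |I|≡1+m = begin
  toℚᵘ ((Nai I ℚ.- Eag I) ℚ.* v)
    ≈⟨ ℚP.toℚᵘ-homo-* (Nai I ℚ.- Eag I) v ⟩
  toℚᵘ (Nai I ℚ.+ ℚ.- Eag I) ℚᵘ.* V
    ≈⟨ ℚᵘP.*-congʳ (ℚᵘP.≃-trans (ℚP.toℚᵘ-homo-+ (Nai I) (ℚ.- Eag I))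
                                (ℚᵘP.+-congʳ (toℚᵘ (Nai I)) (ℚP.toℚᵘ-homo‿- (Eag I)))) ⟩
  (toℚᵘ (Nai I) ℚᵘ.- toℚᵘ (Eag I)) ℚᵘ.* V
    ≈⟨ ℚᵘP.*-congʳ (ℚᵘP.+-cong (aggregate-≃ (count I) v I)
                                (ℚᵘP.-‿cong (aggregate-≃ (count I) v (eagBuffer I)))) ⟩
  (S ℚᵘ.* V ℚᵘ.- E ℚᵘ.* V) ℚᵘ.* V
    ≈⟨ factor S E V ⟩
  (S ℚᵘ.- E) ℚᵘ.* (V ℚᵘ.* V)
    ≈⟨ ℚᵘP.*-congˡ (ℚᵘP.*-cong V≃1/n V≃1/n) ⟩
  (S ℚᵘ.- E) ℚᵘ.* (mkℚᵘ (+ 1) m ℚᵘ.* mkℚᵘ (+ 1) m)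
    ≈⟨ *≡* (trans (cross-multiplied (+ naiMass I) (+ eagMass I) (+ (suc m * suc m)))
                  (cong (λ k → (+ naiMass I ℤ.- + eagMass I) ℤ.* + k) (sym (ℕP.*-identityˡ (suc m * suc m))))) ⟩
  fraction (naiMass I) (eagMass I) (m + m * suc m) ∎
  where
  open ℚᵘP.≃-Reasoning
  open +-*-Solver
  v = inv (length I)
  V = toℚᵘ v
  S = mkℚᵘ (+ naiMass I) 0
  E = mkℚᵘ (+ eagMass I) 0
  V≃1/n : V ≃ mkℚᵘ (+ 1) m
  V≃1/n rewrite |I|≡1+m = ℚP.toℚᵘ-fromℚᵘ (mkℚᵘ (+ 1) m)
  factor : ∀ s e v → (s ℚᵘ.* v ℚᵘ.- e ℚᵘ.* v) ℚᵘ.* v ≃ (s ℚᵘ.- e) ℚᵘ.* (v ℚᵘ.* v)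
  factor = solve 3 (λ s e v → (s :* v :- e :* v) :* v := (s :- e) :* (v :* v)) ℚᵘP.≃-refl
  cross-multiplied : ∀ (s e k : ℤ) → ((s ℤ.* + 1 ℤ.+ (ℤ.- e) ℤ.* + 1) ℤ.* (+ 1 ℤ.* + 1)) ℤ.* k ≡ (s ℤ.- e) ℤ.* k
  cross-multiplied = ℤSolver.solve-∀

≤-via-ℚᵘ : ∀ {x y : ℚ} {X Y : ℚᵘ} → toℚᵘ x ≃ X → toℚᵘ y ≃ Y → X ℚᵘ.≤ Y → x ℚ.≤ y
≤-via-ℚᵘ x≃X y≃Y X≤Y =
  ℚP.toℚᵘ-cancel-≤ (ℚᵘP.≤-respˡ-≃ (ℚᵘP.≃-sym x≃X) (ℚᵘP.≤-respʳ-≃ (ℚᵘP.≃-sym y≃Y) X≤Y))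

diffRatio-≤ : ∀ I {m s e} c d q {y : ℚ} → length I ≡ suc m → naiMass I ≡ s → eagMass I ≡ e →
  toℚᵘ y ≃ fraction c d q →
  s * suc q + d * (suc m * suc m) ≤ c * (suc m * suc m) + e * suc q → diffRatio I ℚ.≤ y
diffRatio-≤ I {m} c d q |I| refl refl y≃ h =
  ≤-via-ℚᵘ (diffRatio-≃ I |I|) y≃ (fraction-≤ (naiMass I) (eagMass I) (m + m * suc m) c d q h)

diffRatio-≥ : ∀ I {m s e} c d q {y : ℚ} → length I ≡ suc m → naiMass I ≡ s → eagMass I ≡ e →
  toℚᵘ y ≃ fraction c d q →
  c * (suc m * suc m) + e * suc q ≤ s * suc q + d * (suc m * suc m) → y ℚ.≤ diffRatio I
diffRatio-≥ I {m} c d q |I| refl refl y≃ h =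
  ≤-via-ℚᵘ y≃ (diffRatio-≃ I |I|) (fraction-≤ c d q (naiMass I) (eagMass I) (m + m * suc m) h)

diffRatio≥-¼ : ∀ I → -[1+ 0 ] / 4 ℚ.≤ diffRatio I
diffRatio≥-¼ []          = ℚ.*≤* ℤ.-≤+
diffRatio≥-¼ I@(_ ∷ _) = diffRatio-≥ I 0 1 3 refl refl refl (*≡* refl)
  (subst₂ _≤_ (ℕP.*-comm 4 (eagMass I))
              (cong₂ _+_ (ℕP.*-comm 4 (naiMass I)) (sym (ℕP.*-identityˡ (length I * length I))))
              (eagMass-bound I))

diffRatio≤1 : ∀ I → diffRatio I ℚ.≤ + 1 / 1
diffRatio≤1 []          = ℚ.*≤* (ℤ.+≤+ z≤n)
diffRatio≤1 I@(_ ∷ _) = diffRatio-≤ I 1 0 0 refl refl refl (*≡* refl)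
  (subst₂ _≤_ (padˡ (naiMass I) (length I * length I)) (padʳ (length I * length I) (eagMass I))
              (ℕP.m≤n⇒m≤n+o (eagMass I) (naiMass≤square I)))
  where
  padˡ : ∀ s N → s ≡ s * 1 + 0 * N
  padˡ = ℕSolver.solve-∀
  padʳ : ∀ N e → N + e ≡ 1 * N + e * 1
  padʳ = ℕSolver.solve-∀

zigzag : ℕ → List ℕ
zigzag zero    = []
zigzag (suc k) = suc k ∷ 0 ∷ zigzag k

-- The family for Min: 0 0 k 0 (k−1) 0 … 1 0.  Eag locks onto the item 0, of
-- frequency ≈ 1/2, while Nai mostly holds items occurring only once.
minInput : ℕ → List ℕ
minInput k = 0 ∷ 0 ∷ zigzag k

length-zigzag : ∀ k → length (zigzag k) ≡ k + k
length-zigzag zero    = refl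
length-zigzag (suc k) = cong suc (trans (cong suc (length-zigzag k)) (sym (ℕP.+-suc k k)))

count-zigzag-0 : ∀ k → count (zigzag k) 0 ≡ k
count-zigzag-0 zero    = refl
count-zigzag-0 (suc k) = cong suc (count-zigzag-0 k)

count-zigzag-absent : ∀ k j → k ≤ j → count (zigzag k) (suc j) ≡ 0
count-zigzag-absent zero    j _   = refl
count-zigzag-absent (suc k) j k<j =
  trans (count-there (0 ∷ zigzag k) (λ eq → ℕP.<⇒≢ k<j (ℕP.suc-injective eq)))
        (count-zigzag-absent k j (ℕP.<⇒≤ k<j))

count-zigzag-once : ∀ k j → j < k → count (zigzag k) (suc j) ≡ 1
count-zigzag-once (suc k) j (s≤s j≤k) with ℕP.m≤n⇒m<n∨m≡n j≤k
... | inj₁ j<k  = trans (count-there (0 ∷ zigzag k) (λ eq → ℕP.<⇒≢ j<k (sym (ℕP.suc-injective eq))))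
                        (count-zigzag-once k j j<k)
... | inj₂ refl = trans (count-here (suc j) (0 ∷ zigzag j))
                        (cong suc (count-zigzag-absent j j ℕP.≤-refl))

weight-zigzag : ∀ c k → (∀ i → i < k → c (suc i) ≡ 1) → weight c (zigzag k) ≡ k * suc (c 0)
weight-zigzag c zero    once = refl
weight-zigzag c (suc k) once =
  cong₂ (λ u w → u + (c 0 + w)) (once k ℕP.≤-refl)
        (weight-zigzag c k (λ i i<k → once i (ℕP.m≤n⇒m≤1+n i<k)))

minInput-length : ∀ k → length (minInput k) ≡ suc (suc (k + k))
minInput-length k = cong (λ l → suc (suc l)) (length-zigzag k)

minInput-long : ∀ k → k ≤ length (minInput k)
minInput-long k = subst (k ≤_) (sym (minInput-length k))
                        (ℕP.m≤n⇒m≤1+n (ℕP.m≤n⇒m≤1+n (ℕP.m≤m+n k k)))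

naiMass-minInput : ∀ k → naiMass (minInput k) ≡ (k + 2) * (k + 2) + k
naiMass-minInput k = begin
  c 0 + (c 0 + weight c (zigzag k))
    ≡⟨ cong (λ w → c 0 + (c 0 + w)) (weight-zigzag c k (count-zigzag-once k)) ⟩
  c 0 + (c 0 + k * suc (c 0))
    ≡⟨ cong (λ z → z + (z + k * suc z)) (cong (λ z → suc (suc z)) (count-zigzag-0 k)) ⟩
  (2 + k) + ((2 + k) + k * (3 + k))
    ≡⟨ tidy k ⟩
  (k + 2) * (k + 2) + k ∎
  where
  open ≡-Reasoning
  c = count (minInput k)
  tidy : ∀ k → (2 + k) + ((2 + k) + k * (3 + k)) ≡ (k + 2) * (k + 2) + k
  tidy = ℕSolver.solve-∀

eagMass-minInput : ∀ k → eagMass (minInput k) ≡ (2 * k + 2) * (k + 2)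
eagMass-minInput k = begin
  weight c (replicate (length (minInput k)) 0)  ≡⟨ weight-replicate c (length (minInput k)) 0 ⟩
  length (minInput k) * c 0                     ≡⟨ cong₂ _*_ (minInput-length k) (cong (λ z → suc (suc z)) (count-zigzag-0 k)) ⟩
  (2 + (k + k)) * (2 + k)                       ≡⟨ tidy k ⟩
  (2 * k + 2) * (k + 2)                         ∎
  where
  open ≡-Reasoning
  c = count (minInput k)
  tidy : ∀ k → (2 + (k + k)) * (2 + k) ≡ (2 * k + 2) * (k + 2)
  tidy = ℕSolver.solve-∀

-- diffRatio (minInput k) = −1/4 + 1/(4(k+1)) ≤ −1/4 + 1/(k+1)
minInput-close : ∀ k → diffRatio (minInput k) ℚ.≤ -[1+ 0 ] / 4 ℚ.+ + 1 / suc k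
minInput-close k =
  diffRatio-≤ (minInput k) (0 * suc k + 1 * 4) (1 * suc k + 0 * 4) (k + 3 * suc k)
    (minInput-length k) (naiMass-minInput k) (eagMass-minInput k) target
    (≤-by-slack (12 * (k + 1) * (k + 1)) (cross k))
  where
  target : toℚᵘ (-[1+ 0 ] / 4 ℚ.+ + 1 / suc k)
             ≃ fraction (0 * suc k + 1 * 4) (1 * suc k + 0 * 4) (k + 3 * suc k)
  target = ℚᵘP.≃-trans (ℚP.toℚᵘ-homo-+ (-[1+ 0 ] / 4) (+ 1 / suc k))
             (ℚᵘP.≃-trans (ℚᵘP.+-congʳ (fraction 0 1 3) (toℚᵘ-fraction 1 k)) (fraction-+ 0 1 3 1 0 k))
  cross : ∀ k → ((k + 2) * (k + 2) + k) * suc (k + 3 * suc k)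
                  + (1 * suc k + 0 * 4) * (suc (suc (k + k)) * suc (suc (k + k)))
                  + 12 * (k + 1) * (k + 1)
                ≡ (0 * suc k + 1 * 4) * (suc (suc (k + k)) * suc (suc (k + k)))
                  + (2 * k + 2) * (k + 2) * suc (k + 3 * suc k)
  cross = ℕSolver.solve-∀

count-replicate-same : ∀ k a → count (replicate k a) a ≡ k
count-replicate-same zero    a = refl
count-replicate-same (suc k) a = trans (count-here a (replicate k a)) (cong suc (count-replicate-same k a))

count-replicate-other : ∀ k {x a} → x ≢ a → count (replicate k x) a ≡ 0
count-replicate-other zero    x≢a = refl
count-replicate-other (suc k) {x} x≢a =
  trans (count-there (replicate k x) x≢a) (count-replicate-other k x≢a)

-- The family for Max: 0 0 1 1 … 1 (k ones).  Eag locks onto the rare item 0,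
-- Nai holds the item 1 of frequency ≈ 1.
maxInput : ℕ → List ℕ
maxInput k = 0 ∷ 0 ∷ replicate k 1

maxInput-length : ∀ k → length (maxInput k) ≡ suc (suc k)
maxInput-length k = cong (λ l → suc (suc l)) (length-replicate k)

maxInput-long : ∀ k → k ≤ length (maxInput k)
maxInput-long k = subst (k ≤_) (sym (maxInput-length k)) (ℕP.m≤n⇒m≤1+n (ℕP.n≤1+n k))

count-maxInput-0 : ∀ k → count (maxInput k) 0 ≡ 2
count-maxInput-0 k = cong (λ z → suc (suc z)) (count-replicate-other k (λ ()))

naiMass-maxInput : ∀ k → naiMass (maxInput k) ≡ 4 + k * k
naiMass-maxInput k = begin
  c 0 + (c 0 + weight c (replicate k 1)) ≡⟨ cong (λ w → c 0 + (c 0 + w)) (weight-replicate c k 1) ⟩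
  c 0 + (c 0 + k * c 1)                  ≡⟨ cong₂ (λ z w → z + (z + k * w)) (count-maxInput-0 k) (count-replicate-same k 1) ⟩
  4 + k * k                              ∎
  where
  open ≡-Reasoning
  c = count (maxInput k)

eagMass-maxInput : ∀ k → eagMass (maxInput k) ≡ (k + 2) * 2
eagMass-maxInput k = begin
  weight c (replicate (length (maxInput k)) 0) ≡⟨ weight-replicate c (length (maxInput k)) 0 ⟩
  length (maxInput k) * c 0                    ≡⟨ cong₂ _*_ (maxInput-length k) (count-maxInput-0 k) ⟩
  (2 + k) * 2                                  ≡⟨ cong (_* 2) (ℕP.+-comm 2 k) ⟩
  (k + 2) * 2                                  ∎
  where
  open ≡-Reasoning
  c = count (maxInput k)

-- diffRatio (maxInput k) = 1 − (6k + 4)/(k + 2)² ≥ 1 − 6/(k + 1)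
maxInput-close : ∀ k → + 1 / 1 ℚ.- + 6 / suc k ℚ.≤ diffRatio (maxInput k)
maxInput-close k =
  diffRatio-≥ (maxInput k) (1 * suc k + 0 * 1) (0 * suc k + 6 * 1) (k + 0 * suc k)
    (maxInput-length k) (naiMass-maxInput k) (eagMass-maxInput k) target
    (≤-by-slack (14 * k + 20) (cross k))
  where
  target : toℚᵘ (+ 1 / 1 ℚ.- + 6 / suc k)
             ≃ fraction (1 * suc k + 0 * 1) (0 * suc k + 6 * 1) (k + 0 * suc k)
  target = ℚᵘP.≃-trans (ℚP.toℚᵘ-homo-+ (+ 1 / 1) (ℚ.- (+ 6 / suc k)))
             (ℚᵘP.≃-trans (ℚᵘP.+-congʳ (fraction 1 0 0) (toℚᵘ-neg-fraction 6 k)) (fraction-+ 1 0 0 0 6 k))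
  cross : ∀ k → (1 * suc k + 0 * 1) * (suc (suc k) * suc (suc k)) + (k + 2) * 2 * suc (k + 0 * suc k)
                  + (14 * k + 20)
                ≡ (4 + k * k) * suc (k + 0 * suc k) + (0 * suc k + 6 * 1) * (suc (suc k) * suc (suc k))
  cross = ℕSolver.solve-∀

theorem5 : MinIs diffRatio (-[1+ 0 ] / 4) × MaxIs diffRatio (+ 1 / 1)
theorem5 =
    minIs-intro diffRatio (-[1+ 0 ] / 4) minInput 1 diffRatio≥-¼ minInput-long minInput-close
  , maxIs-intro diffRatio (+ 1 / 1) maxInput 6 diffRatio≤1 maxInput-long maxInput-close
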